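{- Let $G$ be a connected graph and $r\le r'$ natural numbers. Let $p_r:G_r\to G$ and $p_{r'}:G_{r'}\to G$ be the $r$- and $r'$-local coverings of $G$, let $p_{r,r'}:(G_{r'})_r\to G_{r'}$ be the $r$-local covering of $G_{r'}$, and let $q_{r,r'}:G_r\to G_{r'}$ be a covering with $p_r=p_{r'}\circ q_{r,r'}$ (such a covering exists). Then $p_{r,r'}$ and $q_{r,r'}$ are equivalent coverings of $G_{r'}$, and $p_r$ and $p_{r'}\circ p_{r,r'}$ are equivalent coverings of $G$. In particular, $(G_{r'})_r$ and $G_r$ are isomorphic graphs.
   Context: Graphs may have loops and parallel edges and are viewed as 1-complexes; coverings have connected covering spaces. For a connected graph $X$ and vertex $x_0$, a closed walk $W$ at $x_0$ stems from a cycle $O$ if $W=W_0QW_0^-$, with $W_0$ a walk from $x_0$ to a vertex of $O$, $Q$ a closed walk traversing each edge of $O$ exactly once, $W_0^-$ the reverse of $W_0$. $\pi_1^r(X,x_0)$ is the (normal) subgroup of $\pi_1(X,x_0)$ generated by closed walks at $x_0$ stemming from cycles of length at most $r$; the $r$-local covering $X_r\to X$ is the covering with characteristic subgroup $\pi_1^r(X,x_0)$ (its covering space $X_r$ is again a connected graph). -}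

module Defs where

open import Data.Nat using (ℕ; _≤_)
open import Data.List using (List; []; _∷_; _++_; map; reverse; concat; length)
open import Data.List.Relation.Unary.All using (All)
open import Data.List.Relation.Unary.AllPairs using (AllPairs)
open import Data.List.Relation.Unary.Unique.Propositional using (Unique)
open import Data.Product using (Σ; ∃; _×_; _,_)
open import Relation.Binary.PropositionalEquality using (_≡_; _≢_)
open import Relation.Binary.Construct.Closure.Equivalence using (EqClosure)

-- A graph as a 1-complex (loops and parallel edges allowed), given by its
-- darts (oriented edges): each edge {d , rev d} has two orientations,
-- src d is the initial vertex, tgt d = src (rev d) the terminal one.
record Graph : Set₁ where
  field
    V         : Set
    D         : Set
    src       : D → V
    rev       : D → D
    rev-invol : ∀ d → rev (rev d) ≡ d
    rev-nofix : ∀ d → rev d ≢ d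

  tgt : D → V
  tgt d = src (rev d)

open Graph public

module _ (G : Graph) where

  data IsWalk : V G → List (D G) → V G → Set where
    nil  : ∀ {x} → IsWalk x [] x
    cons : ∀ {x d ds y} → src G d ≡ x → IsWalk (tgt G d) ds y → IsWalk x (d ∷ ds) y

  Connected : Set
  Connected = ∀ x y → ∃ λ ds → IsWalk x ds y

  revWalk : List (D G) → List (D G)
  revWalk ds = reverse (map (rev G) ds)

  data Backtrack : List (D G) → List (D G) → Set where
    bt : ∀ as d bs → Backtrack (as ++ d ∷ rev G d ∷ bs) (as ++ bs)

  _≃h_ : List (D G) → List (D G) → Set
  _≃h_ = EqClosure Backtrack

  -- Q is a closed walk at v traversing each edge of a cycle O of
  -- length ≤ r exactly once: a closed walk of length 1..r whose vertices
  -- are pairwise distinct and whose edges are pairwise distinct.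
  IsCycleWalk : ℕ → V G → List (D G) → Set
  IsCycleWalk r v qs =
    IsWalk v qs v × 1 ≤ length qs × length qs ≤ r ×
    Unique (map (src G) qs) ×
    AllPairs (λ a b → a ≢ b × a ≢ rev G b) qs

  Stems : ℕ → V G → List (D G) → Set
  Stems r x0 ds = Σ (V G) λ v → Σ (List (D G)) λ w0 → Σ (List (D G)) λ q →
    IsWalk x0 w0 v × IsCycleWalk r v q × ds ≡ w0 ++ q ++ revWalk w0

  -- (the class of) ds lies in π₁^r(G, x0): it is homotopic to a
  -- product of walks stemming from cycles of length ≤ r
  -- (inverses of such walks are again such walks)
  InPi1r : ℕ → V G → List (D G) → Set
  InPi1r r x0 ds = Σ (List (List (D G))) λ ws →
    All (Stems r x0) ws × (concat ws ≃h ds)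

record Hom (H G : Graph) : Set where
  field
    fV      : V H → V G
    fD      : D H → D G
    fsrc    : ∀ d → fV (src H d) ≡ src G (fD d)
    frev    : ∀ d → fD (rev H d) ≡ rev G (fD d)

open Hom public

_∘H_ : ∀ {K H G} → Hom H G → Hom K H → Hom K G
_∘H_ {K} {H} {G} f g = record
  { fV = λ v → fV f (fV g v)
  ; fD = λ d → fD f (fD g d)
  ; fsrc = λ d → Relation.Binary.PropositionalEquality.trans
                   (Relation.Binary.PropositionalEquality.cong (fV f) (fsrc g d)) (fsrc f (fD g d))
  ; frev = λ d → Relation.Binary.PropositionalEquality.trans
                   (Relation.Binary.PropositionalEquality.cong (fD f) (frev g d)) (frev f (fD g d))
  }

_≈H_ : ∀ {H G} → Hom H G → Hom H G → Set
_≈H_ {H} f g = (∀ v → fV f v ≡ fV g v) × (∀ d → fD f d ≡ fD g d)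

IsCovering : ∀ {H G} → Hom H G → Set
IsCovering {H} {G} p = Connected H ×
  (∀ h d → src G d ≡ fV p h →
     Σ (D H) λ d' → (src H d' ≡ h × fD p d' ≡ d) ×
       (∀ d'' → src H d'' ≡ h → fD p d'' ≡ d → d'' ≡ d'))

LiftsClosed : ∀ {H G} → Hom H G → V H → List (D G) → Set
LiftsClosed {H} p h0 ds = Σ (List (D H)) λ ds' → IsWalk H h0 ds' h0 × map (fD p) ds' ≡ ds

-- p : (H,h0) → (G,x0) is the r-local covering of G: a covering whose
-- characteristic subgroup p_*(π₁(H,h0)) (= classes of closed walks at x0
-- whose lift at h0 is closed) equals π₁^r(G,x0)
IsLocalCovering : (G : Graph) → V G → ℕ → (H : Graph) → Hom H G → V H → Set
IsLocalCovering G x0 r H p h0 =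
  IsCovering p × fV p h0 ≡ x0 ×
  (∀ ds → IsWalk G x0 ds x0 → (LiftsClosed p h0 ds → InPi1r G r x0 ds) × (InPi1r G r x0 ds → LiftsClosed p h0 ds))

record Iso (H K : Graph) : Set where
  field
    to   : Hom H K
    from : Hom K H
    from∘to : ∀ v → fV from (fV to v) ≡ v
    to∘from : ∀ v → fV to (fV from v) ≡ v
    from∘toD : ∀ d → fD from (fD to d) ≡ d
    to∘fromD : ∀ d → fD to (fD from d) ≡ d

open Iso public

EquivCov : ∀ {H₁ H₂ G} → Hom H₁ G → Hom H₂ G → Set
EquivCov {H₁} {H₂} p₁ p₂ = Σ (Iso H₁ H₂) λ φ → (p₂ ∘H to φ) ≈H p₁

{-# OPTIONS --safe #-}

-- p_{r,r'} and q are both coverings of G_{r'}.  By the lifting criterion each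
-- maps into the other over G_{r'} (at base points over y_{r'}) as soon as loops
-- of its total space project to walks whose lifts to the other one are closed;
-- the two maps are then mutually inverse, since a covering endomorphism fixing a
-- point is the identity.
--
-- A loop of (G_{r'})_r projects into π₁ʳ(G_{r'}), and p_{r'} maps r-cycles to
-- r-cycles: if two vertices of an r-cycle had the same image, the subwalk
-- between them would project to a closed walk of length ≤ r', which lies
-- (classically, enough for an inequality) in π₁^{r'}(G) and therefore lifts to
-- a closed walk.  The image loop thus lies in π₁ʳ(G) and lifts to a loop of
-- G_r.  Conversely a loop of G_r projects into π₁ʳ(G); an r-cycle of G
-- lifts to an r-cycle of G_{r'}, closed since the cycle lies in π₁^{r'}(G), so
-- every generator of π₁ʳ(G) lifts to a loop of (G_{r'})_r, and lifting respects
-- homotopy.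

module Submission where

open import Defs
open import Data.Nat using (ℕ; _≤_; _+_; suc; s≤s; z≤n)
open import Data.Nat.Properties using (≤-trans; ≤-reflexive; n≤1+n; m≤m+n; m≤n+m; +-mono-≤; +-suc; +-assoc)
open import Data.Product using (_×_; Σ; _,_; proj₁; proj₂; ∃; ∃₂)
open import Data.List using (List; []; _∷_; _++_; map; reverse; concat; length; [_])
open import Data.List.Properties
  using ( map-++; ++-assoc; reverse-++; length-map; ++-identityʳ; reverse-map; map-∘; map-cong
        ; unfold-reverse; concat-++; ∷-injective; length-++; concat-map )
open import Relation.Binary.PropositionalEquality hiding ([_])
open import Relation.Binary.Bundles using (Setoid)
open import Relation.Binary.Construct.Closure.ReflexiveTransitive using (Star; ε; _◅_; _◅◅_)
open import Relation.Binary.Construct.Closure.Symmetric using (fwd; bwd)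
open import Relation.Binary.Construct.Closure.Equivalence as EC using (EqClosure)
import Relation.Binary.Reasoning.Setoid as SetoidReasoning
open import Data.List.Relation.Unary.All as All using (All; []; _∷_)
import Data.List.Relation.Unary.All.Properties as AllP
open import Data.List.Relation.Unary.Any using (here; there)
open import Data.List.Relation.Unary.AllPairs as AllPairs using (AllPairs; []; _∷_)
import Data.List.Relation.Unary.AllPairs.Properties as AllPairs
open import Data.List.Relation.Unary.Unique.Propositional using (Unique)
import Data.List.Relation.Unary.Unique.Propositional.Properties as Unique
open import Data.List.Membership.Propositional using (_∈_; _∉_)
open import Effect.Monad using (RawMonad)
open import Relation.Nullary.Negation using (¬_; ¬¬-Monad)
open import Relation.Nullary.Decidable using (yes; no; ¬¬-excluded-middle)
open import Function using (_∘_)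
import Level
open import Data.Sum using (_⊎_; inj₁; inj₂)

module _ (G : Graph) where

  walk-++ : ∀ {a P b Q c} → IsWalk G a P b → IsWalk G b Q c → IsWalk G a (P ++ Q) c
  walk-++ nil w = w
  walk-++ (cons e w) w' = cons e (walk-++ w w')

  walk-target-unique : ∀ {a P b c} → IsWalk G a P b → IsWalk G a P c → b ≡ c
  walk-target-unique nil nil = refl
  walk-target-unique (cons _ w) (cons _ w') = walk-target-unique w w'

  tgt-rev : ∀ d → tgt G (rev G d) ≡ src G d
  tgt-rev d = cong (src G) (rev-invol G d)

  revWalk-∷ : ∀ d P → revWalk G (d ∷ P) ≡ revWalk G P ++ [ rev G d ]
  revWalk-∷ d P = unfold-reverse (rev G d) (map (rev G) P)

  revWalk-++ : ∀ P Q → revWalk G (P ++ Q) ≡ revWalk G Q ++ revWalk G P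
  revWalk-++ P Q = trans (cong reverse (map-++ (rev G) P Q)) (reverse-++ (map (rev G) P) (map (rev G) Q))

  revWalk-involutive : ∀ P → revWalk G (revWalk G P) ≡ P
  revWalk-involutive [] = refl
  revWalk-involutive (d ∷ P) = begin
    revWalk G (revWalk G (d ∷ P))            ≡⟨ cong (revWalk G) (revWalk-∷ d P) ⟩
    revWalk G (revWalk G P ++ [ rev G d ])   ≡⟨ revWalk-++ (revWalk G P) [ rev G d ] ⟩
    rev G (rev G d) ∷ revWalk G (revWalk G P) ≡⟨ cong₂ _∷_ (rev-invol G d) (revWalk-involutive P) ⟩
    d ∷ P                                    ∎
    where open ≡-Reasoning

  walk-revWalk : ∀ {a P b} → IsWalk G a P b → IsWalk G b (revWalk G P) a
  walk-revWalk nil = nil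
  walk-revWalk {P = d ∷ P} (cons refl w) =
    subst (λ L → IsWalk G _ L _) (sym (revWalk-∷ d P)) (walk-++ (walk-revWalk w) back)
    where
    back : IsWalk G (tgt G d) [ rev G d ] (src G d)
    back = cons refl (subst (IsWalk G _ []) (tgt-rev d) nil)

  conj : List (D G) → List (D G) → List (D G)
  conj K W = K ++ W ++ revWalk G K

  walk-conj : ∀ {x K y W} → IsWalk G x K y → IsWalk G y W y → IsWalk G x (conj K W) x
  walk-conj k w = walk-++ k (walk-++ w (walk-revWalk k))

module _ {H G : Graph} (f : Hom H G) where

  tgt-hom : ∀ d → fV f (tgt H d) ≡ tgt G (fD f d)
  tgt-hom d = trans (fsrc f (rev H d)) (cong (src G) (frev f d))

  walk-map : ∀ {a P b} → IsWalk H a P b → IsWalk G (fV f a) (map (fD f) P) (fV f b)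
  walk-map nil = nil
  walk-map {P = d ∷ P} (cons refl w) = cons (sym (fsrc f d)) (subst (λ x → IsWalk G x _ _) (tgt-hom d) (walk-map w))

  map-revWalk : ∀ P → map (fD f) (revWalk H P) ≡ revWalk G (map (fD f) P)
  map-revWalk P = trans (reverse-map (fD f) (map (rev H) P))
    (cong reverse (trans (sym (map-∘ P)) (trans (map-cong (frev f) P) (map-∘ P))))

  map-src-hom : ∀ P → map (src G) (map (fD f) P) ≡ map (fV f) (map (src H) P)
  map-src-hom P = trans (sym (map-∘ P)) (trans (map-cong (λ d → sym (fsrc f d)) P) (map-∘ P))

  map-conj : ∀ K W → map (fD f) (conj H K W) ≡ conj G (map (fD f) K) (map (fD f) W)
  map-conj K W = begin
    map (fD f) (K ++ W ++ revWalk H K)                     ≡⟨ map-++ (fD f) K _ ⟩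
    map (fD f) K ++ map (fD f) (W ++ revWalk H K)          ≡⟨ cong (map (fD f) K ++_) (map-++ (fD f) W _) ⟩
    map (fD f) K ++ map (fD f) W ++ map (fD f) (revWalk H K) ≡⟨ cong (λ L → map (fD f) K ++ map (fD f) W ++ L) (map-revWalk K) ⟩
    conj G (map (fD f) K) (map (fD f) W)                   ∎
    where open ≡-Reasoning

module Homotopy (G : Graph) where

  infix 4 _↝_ _≈_

  -- Backtrack in inductive form, so that confluence can be proved by matching.
  data _↝_ : List (D G) → List (D G) → Set where
    here  : ∀ d ds → d ∷ rev G d ∷ ds ↝ ds
    there : ∀ d {ds ds'} → ds ↝ ds' → d ∷ ds ↝ d ∷ ds'

  _≈_ : List (D G) → List (D G) → Set
  _≈_ = EqClosure _↝_

  ↝-pre : ∀ xs {ds ds'} → ds ↝ ds' → xs ++ ds ↝ xs ++ ds'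
  ↝-pre [] s = s
  ↝-pre (x ∷ xs) s = there x (↝-pre xs s)

  ↝-post : ∀ ys {ds ds'} → ds ↝ ds' → ds ++ ys ↝ ds' ++ ys
  ↝-post ys (here d ds) = here d (ds ++ ys)
  ↝-post ys (there x s) = there x (↝-post ys s)

  Backtrack⇒↝ : ∀ {ds ds'} → Backtrack G ds ds' → ds ↝ ds'
  Backtrack⇒↝ (bt as d bs) = ↝-pre as (here d bs)

  ↝⇒Backtrack : ∀ {ds ds'} → ds ↝ ds' → Backtrack G ds ds'
  ↝⇒Backtrack (here d ds) = bt [] d ds
  ↝⇒Backtrack (there x s) with ↝⇒Backtrack s
  ... | bt as d bs = bt (x ∷ as) d bs

  ≃h⇒≈ : ∀ {ds ds'} → _≃h_ G ds ds' → ds ≈ ds'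
  ≃h⇒≈ = EC.map Backtrack⇒↝

  ≈⇒≃h : ∀ {ds ds'} → ds ≈ ds' → _≃h_ G ds ds'
  ≈⇒≃h = EC.map ↝⇒Backtrack

  ≈-setoid : Setoid _ _
  ≈-setoid = EC.setoid _↝_

  open Setoid ≈-setoid public using () renaming (refl to ≈-refl; sym to ≈-sym; trans to ≈-trans; reflexive to ≈-reflexive)

  ↝⇒≈ : ∀ {ds ds'} → ds ↝ ds' → ds ≈ ds'
  ↝⇒≈ = EC.return

  ≈-pre : ∀ xs {ds ds'} → ds ≈ ds' → xs ++ ds ≈ xs ++ ds'
  ≈-pre xs = EC.gmap (xs ++_) (↝-pre xs)

  ≈-post : ∀ ys {ds ds'} → ds ≈ ds' → ds ++ ys ≈ ds' ++ ys
  ≈-post ys = EC.gmap (_++ ys) (↝-post ys)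

  ≈-++ : ∀ {as as' bs bs'} → as ≈ as' → bs ≈ bs' → as ++ bs ≈ as' ++ bs'
  ≈-++ {as' = as'} {bs = bs} p q = ≈-trans (≈-post bs p) (≈-pre as' q)

  ++-revWalk-cancelˡ : ∀ X Y → X ++ revWalk G X ++ Y ≈ Y
  ++-revWalk-cancelˡ [] Y = ≈-refl
  ++-revWalk-cancelˡ (x ∷ X) Y = begin
    x ∷ X ++ revWalk G (x ∷ X) ++ Y        ≡⟨ cong (λ L → x ∷ X ++ L) reassoc ⟩
    x ∷ X ++ revWalk G X ++ rev G x ∷ Y    ≈⟨ ≈-pre [ x ] (++-revWalk-cancelˡ X (rev G x ∷ Y)) ⟩
    x ∷ rev G x ∷ Y                        ≈⟨ ↝⇒≈ (here x Y) ⟩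
    Y                                      ∎
    where
    open SetoidReasoning ≈-setoid
    reassoc : revWalk G (x ∷ X) ++ Y ≡ revWalk G X ++ rev G x ∷ Y
    reassoc = trans (cong (_++ Y) (revWalk-∷ G x X)) (++-assoc (revWalk G X) [ rev G x ] Y)

  revWalk-++-cancelˡ : ∀ X Y → revWalk G X ++ X ++ Y ≈ Y
  revWalk-++-cancelˡ X Y = begin
    revWalk G X ++ X ++ Y                         ≡⟨ cong (λ L → revWalk G X ++ L ++ Y) (sym (revWalk-involutive G X)) ⟩
    revWalk G X ++ revWalk G (revWalk G X) ++ Y   ≈⟨ ++-revWalk-cancelˡ (revWalk G X) Y ⟩
    Y                                             ∎
    where open SetoidReasoning ≈-setoid

  ↝-diamond : ∀ {as bs cs} → as ↝ bs → as ↝ cs → bs ≡ cs ⊎ ∃ λ ds → bs ↝ ds × cs ↝ ds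
  ↝-diamond (here d bs) (here .d .bs) = inj₁ refl
  ↝-diamond (here d _) (there .d (here ._ bs)) = inj₁ (cong (_∷ bs) (rev-invol G d))
  ↝-diamond (here d _) (there .d (there ._ s)) = inj₂ (_ , s , here d _)
  ↝-diamond (there .d (here ._ bs)) (here d _) = inj₁ (cong (_∷ bs) (sym (rev-invol G d)))
  ↝-diamond (there .d (there ._ s)) (here d _) = inj₂ (_ , here d _ , s)
  ↝-diamond (there x s) (there .x t) with ↝-diamond s t
  ... | inj₁ e = inj₁ (cong (x ∷_) e)
  ... | inj₂ (ds , s' , t') = inj₂ (x ∷ ds , there x s' , there x t')

  ↝-strip : ∀ {as bs cs} → as ↝ bs → Star _↝_ as cs → ∃ λ ds → Star _↝_ bs ds × Star _↝_ cs ds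
  ↝-strip s ε = _ , ε , s ◅ ε
  ↝-strip s (t ◅ ts) with ↝-diamond s t
  ... | inj₁ refl = _ , ts , ε
  ... | inj₂ (ds , s' , t') with ↝-strip t' ts
  ...   | es , p , q = es , s' ◅ p , q

  church-rosser : ∀ {as bs} → as ≈ bs → ∃ λ cs → Star _↝_ as cs × Star _↝_ bs cs
  church-rosser ε = _ , ε , ε
  church-rosser (fwd s ◅ r) with church-rosser r
  ... | cs , p , q = cs , s ◅ p , q
  church-rosser (bwd s ◅ r) with church-rosser r
  ... | cs , p , q with ↝-strip s p
  ...   | ds , p' , q' = ds , p' , q ◅◅ q'

module LocalSubgroup (G : Graph) (r : ℕ) where
  open Homotopy G

  π₁ʳ-resp-≈ : ∀ {x as bs} → InPi1r G r x as → as ≈ bs → InPi1r G r x bs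
  π₁ʳ-resp-≈ (ws , stems , h) as≈bs = ws , stems , ≈⇒≃h (≈-trans (≃h⇒≈ h) as≈bs)

  π₁ʳ-[] : ∀ {x} → InPi1r G r x []
  π₁ʳ-[] = [] , [] , ε

  π₁ʳ-++ : ∀ {x as bs} → InPi1r G r x as → InPi1r G r x bs → InPi1r G r x (as ++ bs)
  π₁ʳ-++ (ws , stems , h) (ws' , stems' , h') =
    ws ++ ws' , AllP.++⁺ stems stems' ,
    ≈⇒≃h (≈-trans (≈-reflexive (sym (concat-++ ws ws'))) (≈-++ (≃h⇒≈ h) (≃h⇒≈ h')))

  Stems⇒π₁ʳ : ∀ {x ds} → Stems G r x ds → InPi1r G r x ds
  Stems⇒π₁ʳ {ds = ds} st = [ ds ] , st ∷ [] , ≈⇒≃h (≈-reflexive (++-identityʳ ds))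

  IsCycleWalk⇒π₁ʳ : ∀ {v Q} → IsCycleWalk G r v Q → InPi1r G r v Q
  IsCycleWalk⇒π₁ʳ {Q = Q} cyc = Stems⇒π₁ʳ (_ , [] , Q , nil , cyc , sym (++-identityʳ Q))

  Stems-conj : ∀ {x K y ds} → IsWalk G x K y → Stems G r y ds → Stems G r x (conj G K ds)
  Stems-conj {K = K} k (v , w₀ , Q , w , cyc , refl) = v , K ++ w₀ , Q , walk-++ G k w , cyc , conj-conj
    where
    open ≡-Reasoning
    conj-conj : conj G K (conj G w₀ Q) ≡ conj G (K ++ w₀) Q
    conj-conj = begin
      K ++ (w₀ ++ Q ++ revWalk G w₀) ++ revWalk G K     ≡⟨ cong (K ++_) (++-assoc w₀ _ _) ⟩
      K ++ w₀ ++ (Q ++ revWalk G w₀) ++ revWalk G K     ≡⟨ cong (λ L → K ++ w₀ ++ L) (++-assoc Q _ _) ⟩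
      K ++ w₀ ++ Q ++ revWalk G w₀ ++ revWalk G K       ≡⟨ sym (++-assoc K w₀ _) ⟩
      (K ++ w₀) ++ Q ++ revWalk G w₀ ++ revWalk G K     ≡⟨ cong (λ L → (K ++ w₀) ++ Q ++ L) (sym (revWalk-++ G K w₀)) ⟩
      (K ++ w₀) ++ Q ++ revWalk G (K ++ w₀)             ∎

  concat-map-conj : ∀ K ws → concat (map (conj G K) ws) ≈ conj G K (concat ws)
  concat-map-conj K [] = ≈-sym (begin
    K ++ [] ++ revWalk G K   ≡⟨ cong (K ++_) (sym (++-identityʳ (revWalk G K))) ⟩
    K ++ revWalk G K ++ []   ≈⟨ ++-revWalk-cancelˡ K [] ⟩
    []                       ∎)
    where open SetoidReasoning ≈-setoid
  concat-map-conj K (W ∷ ws) = begin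
    conj G K W ++ concat (map (conj G K) ws)          ≈⟨ ≈-pre (conj G K W) (concat-map-conj K ws) ⟩
    conj G K W ++ conj G K (concat ws)                ≡⟨ reassoc₁ ⟩
    (K ++ W) ++ revWalk G K ++ K ++ concat ws ++ rK   ≈⟨ ≈-pre (K ++ W) (revWalk-++-cancelˡ K (concat ws ++ rK)) ⟩
    (K ++ W) ++ concat ws ++ rK                       ≡⟨ reassoc₂ ⟩
    conj G K (W ++ concat ws)                         ∎
    where
    open SetoidReasoning ≈-setoid
    rK = revWalk G K
    reassoc₁ : conj G K W ++ conj G K (concat ws) ≡ (K ++ W) ++ rK ++ K ++ concat ws ++ rK
    reassoc₁ = trans (++-assoc K (W ++ rK) _) (trans (cong (K ++_) (++-assoc W rK _)) (sym (++-assoc K W _)))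
    reassoc₂ : (K ++ W) ++ concat ws ++ rK ≡ conj G K (W ++ concat ws)
    reassoc₂ = trans (++-assoc K W _) (cong (K ++_) (sym (++-assoc W (concat ws) rK)))

  π₁ʳ-conj : ∀ {x K y ds} → IsWalk G x K y → InPi1r G r y ds → InPi1r G r x (conj G K ds)
  π₁ʳ-conj {K = K} k (ws , stems , h) =
    map (conj G K) ws , AllP.map⁺ (All.map (Stems-conj k) stems) ,
    ≈⇒≃h (≈-trans (concat-map-conj K ws) (≈-pre K (≈-post (revWalk G K) (≃h⇒≈ h))))

  π₁ʳ-unconj : ∀ {x K y ds} → IsWalk G x K y → InPi1r G r x (conj G K ds) → InPi1r G r y ds
  π₁ʳ-unconj {K = K} {ds = ds} k i = π₁ʳ-resp-≈ (π₁ʳ-conj (walk-revWalk G k) i) (begin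
    rK ++ (K ++ ds ++ rK) ++ revWalk G rK   ≡⟨ cong (λ L → rK ++ (K ++ ds ++ rK) ++ L) (revWalk-involutive G K) ⟩
    rK ++ (K ++ ds ++ rK) ++ K              ≡⟨ cong (rK ++_) (trans (++-assoc K _ K) (cong (K ++_) (++-assoc ds rK K))) ⟩
    rK ++ K ++ ds ++ rK ++ K                ≈⟨ revWalk-++-cancelˡ K (ds ++ rK ++ K) ⟩
    ds ++ rK ++ K                           ≡⟨ cong (λ L → ds ++ rK ++ L) (sym (++-identityʳ K)) ⟩
    ds ++ rK ++ K ++ []                     ≈⟨ ≈-pre ds (revWalk-++-cancelˡ K []) ⟩
    ds ++ []                                ≡⟨ ++-identityʳ ds ⟩
    ds                                      ∎)
    where
    open SetoidReasoning ≈-setoid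
    rK = revWalk G K

module ShortLoops (G : Graph) (R : ℕ) where
  open Homotopy G
  open LocalSubgroup G R
  open RawMonad (¬¬-Monad {Level.zero}) using (_>>=_; pure)

  vertices : List (D G) → V G → List (V G)
  vertices [] b = [ b ]
  vertices (d ∷ P) b = src G d ∷ vertices P b

  end∈vertices : ∀ P b → b ∈ vertices P b
  end∈vertices [] b = here refl
  end∈vertices (d ∷ P) b = there (end∈vertices P b)

  start∈vertices : ∀ {a P b} → IsWalk G a P b → a ∈ vertices P b
  start∈vertices nil = here refl
  start∈vertices (cons refl _) = here refl

  All-vertices⇒All-src : ∀ {Q : V G → Set} P {b} → All Q (vertices P b) → All Q (map (src G) P)
  All-vertices⇒All-src [] _ = []
  All-vertices⇒All-src (d ∷ P) (q ∷ qs) = q ∷ All-vertices⇒All-src P qs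

  All-vertices⇒All-ends : ∀ {Q : V G → Set} {a P b} → IsWalk G a P b → All Q (vertices P b) →
    All (λ g → Q (src G g) × Q (tgt G g)) P
  All-vertices⇒All-ends nil _ = []
  All-vertices⇒All-ends (cons refl w) (q ∷ qs) = (q , All.lookup qs (start∈vertices w)) ∷ All-vertices⇒All-ends w qs

  Unique-vertices⇒Unique-src : ∀ P {b} → Unique (vertices P b) → All (b ≢_) (map (src G) P) × Unique (map (src G) P)
  Unique-vertices⇒Unique-src [] _ = [] , []
  Unique-vertices⇒Unique-src (d ∷ P) {b} (d∉ ∷ u) =
    (λ b≡d → All.lookup d∉ (end∈vertices P b) (sym b≡d)) ∷ proj₁ (Unique-vertices⇒Unique-src P u) ,
    All-vertices⇒All-src P d∉ ∷ proj₂ (Unique-vertices⇒Unique-src P u)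

  path⇒distinct-edges : ∀ {a P b} → IsWalk G a P b → Unique (vertices P b) → AllPairs (λ f g → f ≢ g × f ≢ rev G g) P
  path⇒distinct-edges nil _ = []
  path⇒distinct-edges (cons refl w) (d∉ ∷ u) =
    All.map (λ (≢src , ≢tgt) → (λ eq → ≢src (cong (src G) eq)) , (λ eq → ≢tgt (cong (src G) eq)))
            (All-vertices⇒All-ends w d∉)
    ∷ path⇒distinct-edges w u

  ∈vertices⇒split : ∀ {a P b c} → IsWalk G a P b → c ∈ vertices P b →
    ∃₂ λ P₁ P₂ → P ≡ P₁ ++ P₂ × IsWalk G a P₁ c × IsWalk G c P₂ b
  ∈vertices⇒split nil (here refl) = [] , [] , refl , nil , nil
  ∈vertices⇒split {P = d ∷ P} (cons refl w) (here refl) = [] , d ∷ P , refl , nil , cons refl w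
  ∈vertices⇒split (cons refl w) (there c∈) with ∈vertices⇒split w c∈
  ... | P₁ , P₂ , refl , w₁ , w₂ = _ ∷ P₁ , P₂ , refl , cons refl w₁ , w₂

  All-vertices-prefix : ∀ {Q : V G → Set} P₁ {P₂ b c} → IsWalk G c P₂ b →
    All Q (vertices (P₁ ++ P₂) b) → All Q (vertices P₁ c)
  All-vertices-prefix [] w qs = All.lookup qs (start∈vertices w) ∷ []
  All-vertices-prefix (_ ∷ P₁) w (q ∷ qs) = q ∷ All-vertices-prefix P₁ w qs

  Unique-vertices-prefix : ∀ P₁ {P₂ b c} → IsWalk G c P₂ b → Unique (vertices (P₁ ++ P₂) b) → Unique (vertices P₁ c)
  Unique-vertices-prefix [] w u = [] ∷ []
  Unique-vertices-prefix (_ ∷ P₁) w (d∉ ∷ u) = All-vertices-prefix P₁ w d∉ ∷ Unique-vertices-prefix P₁ w u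

  Unique-vertices-suffix : ∀ P₁ {P₂ b} → Unique (vertices (P₁ ++ P₂) b) → Unique (vertices P₂ b)
  Unique-vertices-suffix [] u = u
  Unique-vertices-suffix (_ ∷ P₁) (_ ∷ u) = Unique-vertices-suffix P₁ u

  All-vertices-snoc : ∀ {Q : V G → Set} {d u u'} P → src G d ≡ u →
    All Q (vertices P u) → Q u' → All Q (vertices (P ++ [ d ]) u')
  All-vertices-snoc [] refl (q ∷ []) q' = q ∷ q' ∷ []
  All-vertices-snoc (_ ∷ P) d-at (q ∷ qs) q' = q ∷ All-vertices-snoc P d-at qs q'

  Unique-vertices-snoc : ∀ {d u u'} P → src G d ≡ u →
    Unique (vertices P u) → u' ∉ vertices P u → Unique (vertices (P ++ [ d ]) u')
  Unique-vertices-snoc [] refl _ u'∉ = ((λ eq → u'∉ (here (sym eq))) ∷ []) ∷ [] ∷ []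
  Unique-vertices-snoc (_ ∷ P) d-at (d∉ ∷ u) u'∉ =
    All-vertices-snoc P d-at d∉ (λ eq → u'∉ (here (sym eq))) ∷ Unique-vertices-snoc P d-at u (u'∉ ∘ there)

  closing-dart⇒cycle : ∀ {d g Q u} → src G d ≡ u → src G g ≡ tgt G d → IsWalk G (tgt G g) Q u →
    Unique (vertices (g ∷ Q) u) → d ≢ rev G g → 2 + length Q ≤ R → IsCycleWalk G R u (d ∷ g ∷ Q)
  closing-dart⇒cycle {d} {g} {Q} refl g-at w path@(g∉ ∷ _) d≢g⁻ len =
    cons refl (cons g-at w) , s≤s z≤n , len , u∉srcs ∷ unique-srcs ,
    (d-vs-g ∷ d-vs-Q) ∷ path⇒distinct-edges (cons g-at w) path
    where
    u∉srcs = proj₁ (Unique-vertices⇒Unique-src (g ∷ Q) path)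
    unique-srcs = proj₂ (Unique-vertices⇒Unique-src (g ∷ Q) path)
    d-vs-g : d ≢ g × d ≢ rev G g
    d-vs-g = (λ eq → All.head u∉srcs (cong (src G) eq)) , d≢g⁻
    d-vs-Q : All (λ g' → d ≢ g' × d ≢ rev G g') Q
    d-vs-Q = All.zipWith
      (λ (u≢ , g≢) → (λ eq → u≢ (cong (src G) eq)) , (λ eq → g≢ (trans g-at (trans (cong (tgt G) eq) (tgt-rev G _)))))
               (AllP.map⁻ (All.tail u∉srcs) , AllP.map⁻ (All-vertices⇒All-src Q g∉))

  π₁ʳ-insert-cycle : ∀ {x u P₁ Q d T} → IsWalk G x (P₁ ++ Q) u → IsCycleWalk G R u (d ∷ Q) →
    InPi1r G R x (P₁ ++ T) → InPi1r G R x ((P₁ ++ Q) ++ d ∷ T)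
  π₁ʳ-insert-cycle {P₁ = P₁} {Q} {d} {T} w cyc i =
    π₁ʳ-resp-≈ (π₁ʳ-++ (Stems⇒π₁ʳ (_ , P₁ ++ Q , d ∷ Q , w , cyc , refl)) i) (begin
      (W ++ (d ∷ Q) ++ revWalk G W) ++ P₁ ++ T
        ≡⟨ reassoc ⟩
      W ++ d ∷ Q ++ revWalk G Q ++ revWalk G P₁ ++ P₁ ++ T
        ≈⟨ ≈-pre W (≈-pre (d ∷ Q) (≈-pre (revWalk G Q) (revWalk-++-cancelˡ P₁ T))) ⟩
      W ++ d ∷ Q ++ revWalk G Q ++ T
        ≈⟨ ≈-pre W (≈-pre [ d ] (++-revWalk-cancelˡ Q T)) ⟩
      W ++ d ∷ T
        ∎)
    where
    open SetoidReasoning ≈-setoid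
    W = P₁ ++ Q
    reassoc : (W ++ (d ∷ Q) ++ revWalk G W) ++ P₁ ++ T ≡ W ++ d ∷ Q ++ revWalk G Q ++ revWalk G P₁ ++ P₁ ++ T
    reassoc = trans (++-assoc W _ _) (cong (λ L → W ++ d ∷ L) (trans (++-assoc Q _ _)
                (cong (Q ++_) (trans (cong (_++ P₁ ++ T) (revWalk-++ G P₁ Q)) (++-assoc (revWalk G Q) _ _)))))

  -- Invariant: P is a path (no repeated vertex).  Each dart of T either extends
  -- P or returns to a vertex of P, closing a cycle or a backtrack.  These case
  -- distinctions are on equalities of vertices and darts, which are not
  -- decidable; hence the double negation.
  path-closing : ∀ {x u} T P → IsWalk G u T x → IsWalk G x P u → Unique (vertices P u) →
    length P + length T ≤ R → ¬ ¬ InPi1r G R x (P ++ T)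
  path-closing [] [] nil nil _ _ = pure π₁ʳ-[]
  path-closing [] (f ∷ P) nil (cons refl _) (f∉ ∷ _) _ = λ _ → All.lookup f∉ (end∈vertices P _) refl
  path-closing {x} {u} (d ∷ T) P (cons d-at w) p path len = ¬¬-excluded-middle >>= λ where
      (no tgt∉) → extend tgt∉
      (yes tgt∈) → close (∈vertices⇒split p tgt∈)
    where
    extend : tgt G d ∉ vertices P u → ¬ ¬ InPi1r G R x (P ++ d ∷ T)
    extend tgt∉ = do
      i ← path-closing T (P ++ [ d ]) w (walk-++ G p (cons d-at nil)) (Unique-vertices-snoc P d-at path tgt∉)
                       (≤-trans (≤-reflexive snoc-length) len)
      pure (subst (InPi1r G R x) (++-assoc P [ d ] T) i)
      where
      snoc-length : length (P ++ [ d ]) + length T ≡ length P + length (d ∷ T)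
      snoc-length = trans (cong (_+ length T) (length-++ P)) (+-assoc (length P) 1 (length T))

    backtrack : ∀ {P₁ g} Q → IsWalk G (tgt G g) Q u → Unique (vertices (g ∷ Q) u) → d ≡ rev G g →
      InPi1r G R x (P₁ ++ T) → ¬ ¬ InPi1r G R x ((P₁ ++ g ∷ Q) ++ d ∷ T)
    backtrack {P₁} {g} [] _ _ d≡g⁻ i = pure (π₁ʳ-resp-≈ i (≈-sym (begin
      (P₁ ++ [ g ]) ++ d ∷ T     ≡⟨ trans (++-assoc P₁ [ g ] _) (cong (λ e → P₁ ++ g ∷ e ∷ T) d≡g⁻) ⟩
      P₁ ++ g ∷ rev G g ∷ T     ≈⟨ ≈-pre P₁ (↝⇒≈ (here g T)) ⟩
      P₁ ++ T                   ∎)))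
      where open SetoidReasoning ≈-setoid
    backtrack (g₂ ∷ Q) (cons g₂-at _) (_ ∷ g₂∉ ∷ _) d≡g⁻ _ =
      λ _ → All.lookup g₂∉ (end∈vertices Q u) (trans g₂-at (trans (cong (src G) (sym d≡g⁻)) d-at))

    close-loop : ∀ {P₁} P₂ → IsWalk G x P₁ (tgt G d) → IsWalk G (tgt G d) P₂ u → Unique (vertices P₂ u) →
      suc (length P₂) ≤ R → InPi1r G R x (P₁ ++ T) → ¬ ¬ InPi1r G R x ((P₁ ++ P₂) ++ d ∷ T)
    close-loop [] p₁ p₂ _ len i =
      pure (π₁ʳ-insert-cycle (walk-++ G p₁ p₂) (cons d-at p₂ , s≤s z≤n , len , [] ∷ [] , [] ∷ []) i)
    close-loop (g ∷ Q) p₁ p₂@(cons g-at q) path len i = ¬¬-excluded-middle >>= λ where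
      (no d≢g⁻) → pure (π₁ʳ-insert-cycle (walk-++ G p₁ p₂) (closing-dart⇒cycle d-at g-at q path d≢g⁻ len) i)
      (yes d≡g⁻) → backtrack Q q path d≡g⁻ i

    close : (∃₂ λ P₁ P₂ → P ≡ P₁ ++ P₂ × IsWalk G x P₁ (tgt G d) × IsWalk G (tgt G d) P₂ u) →
      ¬ ¬ InPi1r G R x (P ++ d ∷ T)
    close (P₁ , P₂ , refl , p₁ , p₂) = do
      i ← path-closing T P₁ w p₁ (Unique-vertices-prefix P₁ p₂ path) (≤-trans prefix-length len)
      close-loop P₂ p₁ p₂ (Unique-vertices-suffix P₁ path) (≤-trans loop-length len) i
      where
      prefix-length : length P₁ + length T ≤ length (P₁ ++ P₂) + length (d ∷ T)
      |P|≡ : length P₁ + length P₂ ≡ length (P₁ ++ P₂)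
      |P|≡ = sym (length-++ P₁)
      prefix-length = +-mono-≤ (≤-trans (m≤m+n (length P₁) (length P₂)) (≤-reflexive |P|≡)) (n≤1+n (length T))
      loop-length : suc (length P₂) ≤ length (P₁ ++ P₂) + length (d ∷ T)
      loop-length = ≤-trans (s≤s (≤-trans (m≤n+m (length P₂) (length P₁)) (≤-trans (≤-reflexive |P|≡) (m≤m+n _ (length T)))))
                            (≤-reflexive (sym (+-suc _ (length T))))

  short-loop∈π₁ʳ : ∀ {x S} → IsWalk G x S x → length S ≤ R → ¬ ¬ InPi1r G R x S
  short-loop∈π₁ʳ {S = S} w len = path-closing S [] w nil ([] ∷ []) len

IsCycleWalk-mono : ∀ {G : Graph} {r r' v Q} → r ≤ r' → IsCycleWalk G r v Q → IsCycleWalk G r' v Q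
IsCycleWalk-mono r≤r' (w , nonempty , short , distinct-vertices , distinct-edges) =
  w , nonempty , ≤-trans short r≤r' , distinct-vertices , distinct-edges

module _ {H G : Graph} (f : Hom H G) where
  private
    module HH = Homotopy H
    module HG = Homotopy G

  ↝-map : ∀ {ds ds'} → ds HH.↝ ds' → map (fD f) ds HG.↝ map (fD f) ds'
  ↝-map (HH.here d ds) = subst (λ e → fD f d ∷ e ∷ map (fD f) ds HG.↝ map (fD f) ds) (sym (frev f d)) (HG.here (fD f d) _)
  ↝-map (HH.there d s) = HG.there (fD f d) (↝-map s)

  module _ {r : ℕ} (map-cycle : ∀ {v Q} → IsCycleWalk H r v Q → IsCycleWalk G r (fV f v) (map (fD f) Q)) where

    Stems-map : ∀ {x ds} → Stems H r x ds → Stems G r (fV f x) (map (fD f) ds)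
    Stems-map (v , w₀ , Q , w , cyc , refl) = fV f v , map (fD f) w₀ , map (fD f) Q , walk-map f w , map-cycle cyc , map-conj f w₀ Q

    π₁ʳ-map : ∀ {x ds} → InPi1r H r x ds → InPi1r G r (fV f x) (map (fD f) ds)
    π₁ʳ-map (ws , stems , h) = map (map (fD f)) ws , AllP.map⁺ (All.map Stems-map stems) ,
      HG.≈⇒≃h (HG.≈-trans (HG.≈-reflexive (concat-map ws)) (EC.gmap (map (fD f)) ↝-map (HH.≃h⇒≈ h)))

∘-IsCovering : ∀ {K H G} (f : Hom H G) (g : Hom K H) → IsCovering f → IsCovering g → IsCovering (f ∘H g)
∘-IsCovering {K} {H} {G} f g (_ , f-cov) (K-conn , g-cov) = K-conn , unique-lift
  where
  unique-lift : ∀ k d → src G d ≡ fV f (fV g k) →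
    Σ (D K) λ d' → (src K d' ≡ k × fD f (fD g d') ≡ d) × (∀ d'' → src K d'' ≡ k → fD f (fD g d'') ≡ d → d'' ≡ d')
  unique-lift k d d-at with f-cov (fV g k) d d-at
  ... | d₁ , (d₁-at , fd₁) , d₁-unique with g-cov k d₁ d₁-at
  ...   | d₂ , (d₂-at , gd₂) , d₂-unique =
    d₂ , (d₂-at , trans (cong (fD f) gd₂) fd₁) ,
    λ d'' d''-at fgd'' → d₂-unique d'' d''-at (d₁-unique (fD g d'') (trans (sym (fsrc g d'')) (cong (fV g) d''-at)) fgd'')

module _ {H G : Graph} (p : Hom H G) where

  LiftsTo : V H → List (D G) → V H → Set
  LiftsTo h ds e = Σ (List (D H)) λ L → IsWalk H h L e × map (fD p) L ≡ ds

  LiftsTo-++ : ∀ {h X e Y k} → LiftsTo h X e → LiftsTo e Y k → LiftsTo h (X ++ Y) k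
  LiftsTo-++ (L , w , pL) (M , w' , pM) = L ++ M , walk-++ H w w' , trans (map-++ (fD p) L M) (cong₂ _++_ pL pM)

  LiftsTo-rev : ∀ {h Y k} → LiftsTo h Y k → LiftsTo k (revWalk G Y) h
  LiftsTo-rev (K , w , refl) = revWalk H K , walk-revWalk H w , map-revWalk p K

  LiftsTo-walk : ∀ {h ds e} → LiftsTo h ds e → IsWalk G (fV p h) ds (fV p e)
  LiftsTo-walk (L , w , refl) = walk-map p w

  LiftsTo-concat : ∀ {h ws} → All (λ ds → LiftsTo h ds h) ws → LiftsTo h (concat ws) h
  LiftsTo-concat [] = [] , nil , refl
  LiftsTo-concat (ds↑ ∷ ws↑) = LiftsTo-++ ds↑ (LiftsTo-concat ws↑)

LiftsTo-∘ : ∀ {K H G} (f : Hom H G) (g : Hom K H) {h ds e} → LiftsTo g h ds e → LiftsTo (f ∘H g) h (map (fD f) ds) e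
LiftsTo-∘ f g (L , w , refl) = L , w , map-∘ L

LiftsTo-resp-≈H : ∀ {H G} {f g : Hom H G} → f ≈H g → ∀ {h ds e} → LiftsTo g h ds e → LiftsTo f h ds e
LiftsTo-resp-≈H (_ , f≈g) (L , w , refl) = L , w , map-cong f≈g L

module Lifting {H G : Graph} (p : Hom H G) (cov : IsCovering p) where
  open Homotopy G

  fD-locally-injective : ∀ {h a b} → src H a ≡ h → src H b ≡ h → fD p a ≡ fD p b → a ≡ b
  fD-locally-injective {h} {a} {b} a-at b-at pa≡pb with proj₂ cov h (fD p a) (trans (sym (fsrc p a)) (cong (fV p) a-at))
  ... | _ , _ , unique = trans (unique a a-at refl) (sym (unique b b-at (sym pa≡pb)))

  lift : ∀ {h ds y} → IsWalk G (fV p h) ds y → ∃ (LiftsTo p h ds)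
  lift nil = _ , [] , nil , refl
  lift {h} (cons {d = d} d-at w) with proj₂ cov h d d-at
  ... | d' , (d'-at , pd') , _ with lift (subst (λ x → IsWalk G x _ _) (sym (trans (tgt-hom p d') (cong (tgt G) pd'))) w)
  ...   | e , L , w' , pL = e , d' ∷ L , cons d'-at w' , cong₂ _∷_ pd' pL

  lift-unique : ∀ {h A B e e'} → IsWalk H h A e → IsWalk H h B e' → map (fD p) A ≡ map (fD p) B → A ≡ B × e ≡ e'
  lift-unique nil nil _ = refl , refl
  lift-unique (cons a-at w) (cons b-at w') pA≡pB with fD-locally-injective a-at b-at (proj₁ (∷-injective pA≡pB))
  ... | refl with lift-unique w w' (proj₂ (∷-injective pA≡pB))
  ...   | refl , e≡e' = refl , e≡e'

  LiftsTo-end-unique : ∀ {h ds e e'} → LiftsTo p h ds e → LiftsTo p h ds e' → e ≡ e'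
  LiftsTo-end-unique (_ , w , pA) (_ , w' , pB) = proj₂ (lift-unique w w' (trans pA (sym pB)))

  ↝-LiftsTo : ∀ {h ds ds' e} → ds ↝ ds' → LiftsTo p h ds e → LiftsTo p h ds' e
  ↝-LiftsTo (here d ds) (l₁ ∷ l₂ ∷ L , cons refl (cons l₂-at w) , pL) =
    L , subst (λ x → IsWalk H x L _) (trans (cong (tgt H) l₂≡rev-l₁) (tgt-rev H l₁)) w , proj₂ (∷-injective pL₂)
    where
    pL₂ = proj₂ (∷-injective pL)
    pl₂ : fD p l₂ ≡ fD p (rev H l₁)
    pl₂ = trans (proj₁ (∷-injective pL₂)) (trans (cong (rev G) (sym (proj₁ (∷-injective pL)))) (sym (frev p l₁)))
    l₂≡rev-l₁ : l₂ ≡ rev H l₁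
    l₂≡rev-l₁ = fD-locally-injective l₂-at refl pl₂
  ↝-LiftsTo (there d s) (l ∷ L , cons l-at w , pL) with ↝-LiftsTo s (L , w , proj₂ (∷-injective pL))
  ... | L' , w' , pL' = l ∷ L' , cons l-at w' , cong₂ _∷_ (proj₁ (∷-injective pL)) pL'

  ↝*-LiftsTo : ∀ {h ds ds' e} → Star _↝_ ds ds' → LiftsTo p h ds e → LiftsTo p h ds' e
  ↝*-LiftsTo ε l = l
  ↝*-LiftsTo (s ◅ ss) l = ↝*-LiftsTo ss (↝-LiftsTo s l)

  -- A homotopy may pass through lists that are not walks, so lifts are only
  -- compared along reductions, to a common reduct.
  ≈-LiftsTo-end : ∀ {h ds ds' e e'} → ds ≈ ds' → LiftsTo p h ds e → LiftsTo p h ds' e' → e ≡ e'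
  ≈-LiftsTo-end ds≈ds' l l' with church-rosser ds≈ds'
  ... | _ , ds↝*cs , ds'↝*cs = LiftsTo-end-unique (↝*-LiftsTo ds↝*cs l) (↝*-LiftsTo ds'↝*cs l')

  LiftsTo-over-loop : ∀ {h ds e} → LiftsTo p h ds e → IsWalk G (fV p h) ds (fV p h) → fV p e ≡ fV p h
  LiftsTo-over-loop ds↑ loop = walk-target-unique G (LiftsTo-walk p ds↑) loop

  fV-surjective : Connected G → ∀ h y → ∃ λ e → fV p e ≡ y
  fV-surjective connected h y with lift (proj₂ (connected (fV p h) y))
  ... | e , ds↑ = e , walk-target-unique G (LiftsTo-walk p ds↑) (proj₂ (connected (fV p h) y))

  -- Lifting Y⁻ from e and appending it to the lift of X gives a lift of X Y⁻,
  -- which is closed; reversed, it is a lift of Y from h ending at e.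

  LiftsTo-ends-agree : ∀ {h X e Y k} → LiftsTo p h X e → LiftsTo p h Y k → fV p e ≡ fV p k →
    (∀ {e'} → LiftsTo p h (X ++ revWalk G Y) e' → e' ≡ h) → e ≡ k
  LiftsTo-ends-agree {h} {Y = Y} x↑ y↑ pe≡pk closes
    with lift (subst (λ z → IsWalk G z (revWalk G Y) (fV p h)) (sym pe≡pk) (walk-revWalk G (LiftsTo-walk p y↑)))
  ... | e' , y⁻↑ with closes (LiftsTo-++ p x↑ y⁻↑)
  ...   | refl = LiftsTo-end-unique (subst (λ Z → LiftsTo p h Z _) (revWalk-involutive G Y) (LiftsTo-rev p y⁻↑)) y↑

module LocalCovering {G : Graph} {x₀ : V G} {r : ℕ} {H : Graph} {p : Hom H G} {h₀ : V H}
                     (lc : IsLocalCovering G x₀ r H p h₀) where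
  open Lifting p (proj₁ lc) public
  open LocalSubgroup G r

  private
    -- generalised over x₀ so that the base-point equation can be matched on
    loop-criterion : ∀ {x₀ ds} → IsLocalCovering G x₀ r H p h₀ → IsWalk G (fV p h₀) ds (fV p h₀) →
      (LiftsTo p h₀ ds h₀ → InPi1r G r (fV p h₀) ds) × (InPi1r G r (fV p h₀) ds → LiftsTo p h₀ ds h₀)
    loop-criterion (_ , refl , criterion) w = criterion _ w

    from-base : ∀ h → ∃ λ C → IsWalk H h₀ C h
    from-base = proj₁ (proj₁ lc) h₀

  π₁ʳ-loop-lifts : ∀ {ds} → IsWalk G x₀ ds x₀ → InPi1r G r x₀ ds → LiftsTo p h₀ ds h₀
  π₁ʳ-loop-lifts loop = proj₂ (proj₂ (proj₂ lc) _ loop)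

  loop-image∈π₁ʳ : ∀ {h A} → IsWalk H h A h → InPi1r G r (fV p h) (map (fD p) A)
  loop-image∈π₁ʳ {h} {A} w with from-base h
  ... | C , c = π₁ʳ-unconj (walk-map p c) (subst (InPi1r G r _) (map-conj p C A) conj-image)
    where
    conj-image : InPi1r G r (fV p h₀) (map (fD p) (conj H C A))
    conj-image = proj₁ (loop-criterion lc (walk-map p (walk-conj H c w))) (_ , walk-conj H c w , refl)

  π₁ʳ-lifts-closed : ∀ {h ds e} → LiftsTo p h ds e → fV p e ≡ fV p h → InPi1r G r (fV p h) ds → e ≡ h
  π₁ʳ-lifts-closed {h} {ds} ds↑ pe≡ph ds∈π₁ʳ with from-base h
  ... | C , c = LiftsTo-ends-agree (LiftsTo-++ p C↑ ds↑) C↑ pe≡ph closes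
    where
    C↑ : LiftsTo p h₀ (map (fD p) C) h
    C↑ = C , c , refl
    closes : ∀ {e'} → LiftsTo p h₀ ((map (fD p) C ++ ds) ++ revWalk G (map (fD p) C)) e' → e' ≡ h₀
    closes loop↑ = LiftsTo-end-unique (subst (λ Z → LiftsTo p h₀ Z _) (++-assoc (map (fD p) C) ds _) loop↑)
      (proj₂ (loop-criterion lc (walk-conj G (walk-map p c) (subst (IsWalk G (fV p h) ds) pe≡ph (LiftsTo-walk p ds↑))))
             (π₁ʳ-conj (walk-map p c) ds∈π₁ʳ))

LoopsLiftClosed : ∀ {H₁ H₂ B} → Hom H₁ B → V H₁ → Hom H₂ B → V H₂ → Set
LoopsLiftClosed {H₁} p₁ h₁ p₂ h₂ =
  fV p₁ h₁ ≡ fV p₂ h₂ × (∀ {A e} → IsWalk H₁ h₁ A h₁ → LiftsTo p₂ h₂ (map (fD p₁) A) e → e ≡ h₂)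

record CoveringMorphism {H₁ H₂ B : Graph} (p₁ : Hom H₁ B) (h₁ : V H₁) (p₂ : Hom H₂ B) (h₂ : V H₂) : Set where
  field
    hom  : Hom H₁ H₂
    over : (p₂ ∘H hom) ≈H p₁
    base : fV hom h₁ ≡ h₂

module LiftingCriterion {H₁ H₂ B : Graph} {p₁ : Hom H₁ B} {p₂ : Hom H₂ B} {h₁ : V H₁} {h₂ : V H₂}
                        (cov₁ : IsCovering p₁) (cov₂ : IsCovering p₂) (loops : LoopsLiftClosed p₁ h₁ p₂ h₂) where
  open Lifting p₂ cov₂

  private
    path : ∀ v → ∃ λ C → IsWalk H₁ h₁ C v
    path = proj₁ cov₁ h₁

    image-path : ∀ v → LiftsTo p₁ h₁ (map (fD p₁) (proj₁ (path v))) v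
    image-path v = proj₁ (path v) , proj₂ (path v) , refl

    lift-from-h₂ : ∀ {v ds} → LiftsTo p₁ h₁ ds v → ∃ (LiftsTo p₂ h₂ ds)
    lift-from-h₂ {v} {ds} ds↑ = lift (subst (λ x → IsWalk B x ds (fV p₁ v)) (proj₁ loops) (LiftsTo-walk p₁ ds↑))

    over-end : ∀ {v ds e} → LiftsTo p₁ h₁ ds v → LiftsTo p₂ h₂ ds e → fV p₂ e ≡ fV p₁ v
    over-end {v} {ds} ds↑₁ ds↑₂ =
      walk-target-unique B (LiftsTo-walk p₂ ds↑₂)
        (subst (λ x → IsWalk B x ds (fV p₁ v)) (proj₁ loops) (LiftsTo-walk p₁ ds↑₁))

  φV : V H₁ → V H₂
  φV v = proj₁ (lift-from-h₂ (image-path v))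

  φV-over : ∀ v → fV p₂ (φV v) ≡ fV p₁ v
  φV-over v = over-end (image-path v) (proj₂ (lift-from-h₂ (image-path v)))

  φV-well-defined : ∀ {v ds e} → LiftsTo p₁ h₁ ds v → LiftsTo p₂ h₂ ds e → e ≡ φV v
  φV-well-defined {v} ds↑₁@(A , a , refl) ds↑₂ =
    LiftsTo-ends-agree ds↑₂ (proj₂ (lift-from-h₂ (image-path v))) (trans (over-end ds↑₁ ds↑₂) (sym (φV-over v))) closes
    where
    C = proj₁ (path v)
    closes : ∀ {e'} → LiftsTo p₂ h₂ (map (fD p₁) A ++ revWalk B (map (fD p₁) C)) e' → e' ≡ h₂
    closes loop↑ = proj₂ loops (walk-++ H₁ a (walk-revWalk H₁ (proj₂ (path v))))
      (subst (λ Z → LiftsTo p₂ h₂ Z _) (sym (trans (map-++ (fD p₁) A _) (cong (map (fD p₁) A ++_) (map-revWalk p₁ C))))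
             loop↑)

  φD-unique : ∀ d → Σ (D H₂) λ d' → (src H₂ d' ≡ φV (src H₁ d) × fD p₂ d' ≡ fD p₁ d) ×
                (∀ d'' → src H₂ d'' ≡ φV (src H₁ d) → fD p₂ d'' ≡ fD p₁ d → d'' ≡ d')
  φD-unique d = proj₂ cov₂ (φV (src H₁ d)) (fD p₁ d) (trans (sym (fsrc p₁ d)) (sym (φV-over (src H₁ d))))

  φD : D H₁ → D H₂
  φD d = proj₁ (φD-unique d)

  φD-src : ∀ d → src H₂ (φD d) ≡ φV (src H₁ d)
  φD-src d = proj₁ (proj₁ (proj₂ (φD-unique d)))

  φD-over : ∀ d → fD p₂ (φD d) ≡ fD p₁ d
  φD-over d = proj₂ (proj₁ (proj₂ (φD-unique d)))

  φD-tgt : ∀ d → tgt H₂ (φD d) ≡ φV (tgt H₁ d)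
  φD-tgt d = φV-well-defined (LiftsTo-++ p₁ (image-path (src H₁ d)) ([ d ] , cons refl nil , refl))
    (LiftsTo-++ p₂ (proj₂ (lift-from-h₂ (image-path (src H₁ d)))) ([ φD d ] , cons (φD-src d) nil , cong [_] (φD-over d)))

  φD-rev : ∀ d → φD (rev H₁ d) ≡ rev H₂ (φD d)
  φD-rev d = sym (proj₂ (proj₂ (φD-unique (rev H₁ d))) (rev H₂ (φD d)) (φD-tgt d)
    (trans (frev p₂ (φD d)) (trans (cong (rev B) (φD-over d)) (sym (frev p₁ d)))))

  morphism : CoveringMorphism p₁ h₁ p₂ h₂
  morphism = record
    { hom  = record { fV = φV ; fD = φD ; fsrc = λ d → sym (φD-src d) ; frev = φD-rev }
    ; over = φV-over , φD-over
    ; base = sym (φV-well-defined ([] , nil , refl) ([] , nil , refl))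
    }

module _ {H₁ H₂ H₃ B : Graph} {p₁ : Hom H₁ B} {p₂ : Hom H₂ B} {p₃ : Hom H₃ B}
         {h₁ : V H₁} {h₂ : V H₂} {h₃ : V H₃} where
  open CoveringMorphism

  CoveringMorphism-∘ : CoveringMorphism p₂ h₂ p₃ h₃ → CoveringMorphism p₁ h₁ p₂ h₂ →
    CoveringMorphism p₁ h₁ p₃ h₃
  CoveringMorphism-∘ ψ φ = record
    { hom  = hom ψ ∘H hom φ
    ; over = (λ v → trans (proj₁ (over ψ) (fV (hom φ) v)) (proj₁ (over φ) v))
           , (λ d → trans (proj₂ (over ψ) (fD (hom φ) d)) (proj₂ (over φ) d))
    ; base = trans (cong (fV (hom ψ)) (base φ)) (base ψ)
    }

module _ {H B : Graph} {p : Hom H B} {h : V H} (cov : IsCovering p) (φ : CoveringMorphism p h p h) where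
  open CoveringMorphism φ
  open Lifting p cov

  CoveringMorphism-selfᵛ : ∀ v → fV hom v ≡ v
  CoveringMorphism-selfᵛ v with proj₁ cov h v
  ... | C , c = proj₂ (lift-unique (subst (λ x → IsWalk H x _ _) base (walk-map hom c)) c
                                   (trans (sym (map-∘ C)) (map-cong (proj₂ over) C)))

  CoveringMorphism-selfᵈ : ∀ d → fD hom d ≡ d
  CoveringMorphism-selfᵈ d = fD-locally-injective (trans (sym (fsrc hom d)) (CoveringMorphism-selfᵛ (src H d))) refl (proj₂ over d)

module _ {H₁ H₂ B : Graph} {p₁ : Hom H₁ B} {p₂ : Hom H₂ B} {h₁ : V H₁} {h₂ : V H₂} where
  open CoveringMorphism

  CoveringMorphisms⇒EquivCov : IsCovering p₁ → IsCovering p₂ →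
    CoveringMorphism p₁ h₁ p₂ h₂ → CoveringMorphism p₂ h₂ p₁ h₁ → EquivCov p₁ p₂
  CoveringMorphisms⇒EquivCov cov₁ cov₂ φ ψ = iso , over φ
    where
    iso : Iso H₁ H₂
    iso = record
      { to = hom φ ; from = hom ψ
      ; from∘to  = CoveringMorphism-selfᵛ cov₁ (CoveringMorphism-∘ ψ φ)
      ; to∘from  = CoveringMorphism-selfᵛ cov₂ (CoveringMorphism-∘ φ ψ)
      ; from∘toD = CoveringMorphism-selfᵈ cov₁ (CoveringMorphism-∘ ψ φ)
      ; to∘fromD = CoveringMorphism-selfᵈ cov₂ (CoveringMorphism-∘ φ ψ)
      }

EquivCov-∘ : ∀ {H₁ H₂ G B} {p₁ : Hom H₁ G} {p₂ : Hom H₂ G} (f : Hom G B) {p : Hom H₁ B} →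
  p ≈H (f ∘H p₁) → EquivCov p₁ p₂ → EquivCov p (f ∘H p₂)
EquivCov-∘ f (p≈fp₁ᵛ , p≈fp₁ᵈ) (iso , p₂φ≈p₁ᵛ , p₂φ≈p₁ᵈ) = iso ,
  (λ v → trans (cong (fV f) (p₂φ≈p₁ᵛ v)) (sym (p≈fp₁ᵛ v))) ,
  (λ d → trans (cong (fD f) (p₂φ≈p₁ᵈ d)) (sym (p≈fp₁ᵈ d)))

module LocalCoveringCycles {G : Graph} {x₀ : V G} {r r' : ℕ} (r≤r' : r ≤ r') {H : Graph} {p : Hom H G} {h₀ : V H}
                           (lc : IsLocalCovering G x₀ r' H p h₀) where
  open LocalCovering {x₀ = x₀} {r = r'} {p = p} {h₀ = h₀} lc

  fV-short-walk-injective : ∀ {a S b} → IsWalk H a S b → length S ≤ r' → fV p a ≡ fV p b → ¬ ¬ a ≡ b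
  fV-short-walk-injective {S = S} w len pa≡pb = do
    i ← ShortLoops.short-loop∈π₁ʳ G r' (subst (IsWalk G _ _) (sym pa≡pb) (walk-map p w))
                                       (≤-trans (≤-reflexive (length-map (fD p) S)) len)
    pure (sym (π₁ʳ-lifts-closed (_ , w , refl) (sym pa≡pb) i))
    where open RawMonad (¬¬-Monad {Level.zero}) using (_>>=_; pure)

  ShortWalk : V H → V H → ℕ → Set
  ShortWalk a c n = ∃ λ P → IsWalk H a P c × length P ≤ n

  dart-ends-reachable : ∀ {a W b} → IsWalk H a W b →
    All (λ e → ShortWalk a (src H e) (length W) × ShortWalk a (tgt H e) (length W)) W
  dart-ends-reachable nil = []
  dart-ends-reachable (cons {d = d} refl w) =
    (([] , nil , z≤n) , ([ d ] , cons refl nil , s≤s z≤n))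
    ∷ All.map (λ (to-src , to-tgt) → extend to-src , extend to-tgt) (dart-ends-reachable w)
    where
    extend : ∀ {c n} → ShortWalk (tgt H d) c n → ShortWalk (src H d) c (suc n)
    extend (P , w' , len) = d ∷ P , cons refl w' , s≤s len

  ImagesDistinct : D H → D H → Set
  ImagesDistinct d e = fV p (src H d) ≢ fV p (src H e) × (fD p d ≢ fD p e × fD p d ≢ rev G (fD p e))

  images-distinct : ∀ {a W b} → IsWalk H a W b → length W ≤ r' → Unique (map (src H) W) →
    AllPairs (λ d e → d ≢ e × d ≢ rev H e) W → AllPairs ImagesDistinct W
  images-distinct nil _ _ _ = []
  images-distinct {W = d ∷ W} (cons refl w) len (d∉ ∷ unique) (d-distinct ∷ distinct) =
    All.zipWith (λ ((to-src , to-tgt) , (src≢ , _ , d≢e⁻)) → head-distinct to-src to-tgt src≢ d≢e⁻)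
      (All.tail (dart-ends-reachable (cons refl w)) , All.zip (AllP.map⁻ d∉ , d-distinct))
    ∷ images-distinct w (≤-trans (n≤1+n _) len) unique distinct
    where
    head-distinct : ∀ {e} → ShortWalk (src H d) (src H e) (suc (length W)) → ShortWalk (src H d) (tgt H e) (suc (length W)) →
      src H d ≢ src H e → d ≢ rev H e → ImagesDistinct d e
    head-distinct {e} (_ , to-src , len-src) (_ , to-tgt , len-tgt) src≢ d≢e⁻ =
      src-images≢ , (λ eq → src-images≢ (src-image eq)) , d≢e⁻-image
      where
      src-images≢ : fV p (src H d) ≢ fV p (src H e)
      src-images≢ eq = fV-short-walk-injective to-src (≤-trans len-src len) eq src≢
      src-image : ∀ {e'} → fD p d ≡ fD p e' → fV p (src H d) ≡ fV p (src H e')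
      src-image {e'} eq = trans (fsrc p d) (trans (cong (src G) eq) (sym (fsrc p e')))
      d≢e⁻-image : fD p d ≢ rev G (fD p e)
      d≢e⁻-image eq = fV-short-walk-injective to-tgt (≤-trans len-tgt len) (src-image eq')
                        (λ src≡tgt → d≢e⁻ (fD-locally-injective refl (sym src≡tgt) eq'))
        where
        eq' : fD p d ≡ fD p (rev H e)
        eq' = trans eq (sym (frev p e))

  cycle-image : ∀ {v Q} → IsCycleWalk H r v Q → IsCycleWalk G r (fV p v) (map (fD p) Q)
  cycle-image {Q = Q} (w , nonempty , short , unique , distinct) =
    walk-map p w , subst (1 ≤_) (sym |pQ|≡|Q|) nonempty , subst (_≤ r) (sym |pQ|≡|Q|) short ,
    subst Unique (sym (map-src-hom p Q)) (AllPairs.map⁺ (AllPairs.map⁺ (AllPairs.map proj₁ images))) ,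
    AllPairs.map⁺ (AllPairs.map proj₂ images)
    where
    |pQ|≡|Q| = length-map (fD p) Q
    images = images-distinct w (≤-trans short r≤r') unique distinct

  cycle-lift : ∀ {v Q e} → IsWalk H v Q e → IsCycleWalk G r (fV p v) (map (fD p) Q) → IsCycleWalk H r v Q
  cycle-lift {Q = Q} w cyc@(w' , nonempty , short , unique , distinct) =
    subst (IsWalk H _ Q) closed w , subst (1 ≤_) |pQ|≡|Q| nonempty , subst (_≤ r) |pQ|≡|Q| short ,
    Unique.map⁻ (subst Unique (map-src-hom p Q) unique) ,
    AllPairs.map distinct-from-images (AllPairs.map⁻ distinct)
    where
    |pQ|≡|Q| = length-map (fD p) Q
    distinct-from-images : ∀ {a b} → fD p a ≢ fD p b × fD p a ≢ rev G (fD p b) → a ≢ b × a ≢ rev H b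
    distinct-from-images {b = b} (≢ , ≢⁻) = (λ eq → ≢ (cong (fD p) eq)) , (λ eq → ≢⁻ (trans (cong (fD p) eq) (frev p b)))
    closed = π₁ʳ-lifts-closed (_ , w , refl) (walk-target-unique G (walk-map p w) w')
               (LocalSubgroup.IsCycleWalk⇒π₁ʳ G r' (IsCycleWalk-mono r≤r' cyc))

module IteratedLocalCovering {G : Graph} {x₀ : V G} {r r' : ℕ} (r≤r' : r ≤ r')
  {H' : Graph} {p' : Hom H' G} {h' : V H'} (lc' : IsLocalCovering G x₀ r' H' p' h')
  {H'' : Graph} {p'' : Hom H'' H'} {h'' : V H''} (lc'' : IsLocalCovering H' h' r H'' p'' h'') where
  private
    module LC' = LocalCovering {x₀ = x₀} {r = r'} {p = p'} {h₀ = h'} lc'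
    module LC'' = LocalCovering {x₀ = h'} {r = r} {p = p''} {h₀ = h''} lc''
  open LocalCoveringCycles {x₀ = x₀} r≤r' {p = p'} {h₀ = h'} lc' using (cycle-lift)
  open Lifting (p' ∘H p'') (∘-IsCovering p' p'' (proj₁ lc') (proj₁ lc''))

  Stems-lift-closed : ∀ {ds} → Stems G r (fV p' h') ds → LiftsTo (p' ∘H p'') h'' ds h''
  Stems-lift-closed (v , w₀ , Q , w , cyc , refl) with LC'.lift w
  ... | v' , W₀ , w₀' , refl with walk-target-unique G (walk-map p' w₀') w
  ...   | refl with LC'.lift (proj₁ cyc)
  ...     | _ , Q' , q' , refl =
    subst (λ ds → LiftsTo (p' ∘H p'') h'' ds h'') (map-conj p' W₀ Q') (LiftsTo-∘ p' p'' stem↑)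
    where
    cyc' : IsCycleWalk H' r v' Q'
    cyc' = cycle-lift q' cyc
    stem↑ : LiftsTo p'' h'' (conj H' W₀ Q') h''
    stem↑ = LC''.π₁ʳ-loop-lifts (walk-conj H' w₀' (proj₁ cyc'))
              (LocalSubgroup.Stems⇒π₁ʳ H' r (v' , W₀ , Q' , w₀' , cyc' , refl))

  π₁ʳ-lifts-closed : ∀ {ds e} → InPi1r G r (fV p' h') ds → LiftsTo (p' ∘H p'') h'' ds e → e ≡ h''
  π₁ʳ-lifts-closed (ws , stems , ws≃ds) ds↑ =
    sym (≈-LiftsTo-end (Homotopy.≃h⇒≈ G ws≃ds) (LiftsTo-concat (p' ∘H p'') (All.map Stems-lift-closed stems)) ds↑)

module LocalCoveringComparison (G : Graph) (x₀ : V G) (r r' : ℕ) (r≤r' : r ≤ r')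
  (Gr : Graph) (pr : Hom Gr G) (yr : V Gr) (lcr : IsLocalCovering G x₀ r Gr pr yr)
  (Gr' : Graph) (pr' : Hom Gr' G) (yr' : V Gr') (lcr' : IsLocalCovering G x₀ r' Gr' pr' yr')
  (Grr' : Graph) (prr' : Hom Grr' Gr') (z : V Grr') (lcrr' : IsLocalCovering Gr' yr' r Grr' prr' z)
  (q : Hom Gr Gr') (q-cov : IsCovering q) (pr≈pr'∘q : pr ≈H (pr' ∘H q)) where
  private
    module LCr = LocalCovering {x₀ = x₀} {r = r} {p = pr} {h₀ = yr} lcr
    module LCrr' = LocalCovering {x₀ = yr'} {r = r} {p = prr'} {h₀ = z} lcrr'
    module Lq = Lifting q q-cov
    open LocalCoveringCycles {x₀ = x₀} r≤r' {p = pr'} {h₀ = yr'} lcr' using (cycle-image)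
    open IteratedLocalCovering {x₀ = x₀} r≤r' {p' = pr'} {h' = yr'} lcr' {p'' = prr'} {h'' = z} lcrr' using (π₁ʳ-lifts-closed)

    z-over-yr' : fV prr' z ≡ yr'
    z-over-yr' = proj₁ (proj₂ lcrr')

  -- q yr need not be yr', so the comparison is based at a vertex y* over yr'.
  y* : V Gr
  y* = proj₁ (Lq.fV-surjective (proj₁ (proj₁ lcr')) yr yr')

  y*-over-yr' : fV q y* ≡ yr'
  y*-over-yr' = proj₂ (Lq.fV-surjective (proj₁ (proj₁ lcr')) yr yr')

  pr-y* : fV pr y* ≡ fV pr' yr'
  pr-y* = trans (proj₁ pr≈pr'∘q y*) (cong (fV pr') y*-over-yr')

  loops-Grr'⊆Gr : LoopsLiftClosed prr' z q y*
  loops-Grr'⊆Gr = trans z-over-yr' (sym y*-over-yr') , closes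
    where
    closes : ∀ {A e} → IsWalk Grr' z A z → LiftsTo q y* (map (fD prr') A) e → e ≡ y*
    closes {A} {e} a A↑ =
      LCr.π₁ʳ-lifts-closed (LiftsTo-resp-≈H {f = pr} {g = pr' ∘H q} pr≈pr'∘q (LiftsTo-∘ pr' q A↑)) pr-e≡pr-y* A∈π₁ʳ
      where
      A∈π₁ʳ : InPi1r G r (fV pr y*) (map (fD pr') (map (fD prr') A))
      A∈π₁ʳ = subst (λ x → InPi1r G r x _) (trans (cong (fV pr') z-over-yr') (sym pr-y*))
                (π₁ʳ-map pr' cycle-image (LCrr'.loop-image∈π₁ʳ a))
      q-e≡q-y* : fV q e ≡ fV q y*
      q-e≡q-y* = Lq.LiftsTo-over-loop A↑ (subst (λ x → IsWalk Gr' x _ x) (trans z-over-yr' (sym y*-over-yr')) (walk-map prr' a))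
      pr-e≡pr-y* : fV pr e ≡ fV pr y*
      pr-e≡pr-y* = trans (proj₁ pr≈pr'∘q e) (trans (cong (fV pr') q-e≡q-y*) (sym (proj₁ pr≈pr'∘q y*)))

  loops-Gr⊆Grr' : LoopsLiftClosed q y* prr' z
  loops-Gr⊆Grr' = trans y*-over-yr' (sym z-over-yr') , closes
    where
    closes : ∀ {A e} → IsWalk Gr y* A y* → LiftsTo prr' z (map (fD q) A) e → e ≡ z
    closes {A} a A↑ = π₁ʳ-lifts-closed (subst₂ (InPi1r G r) pr-y* pr-A (LCr.loop-image∈π₁ʳ a)) (LiftsTo-∘ pr' prr' A↑)
      where
      pr-A : map (fD pr) A ≡ map (fD pr') (map (fD q) A)
      pr-A = trans (map-cong (proj₂ pr≈pr'∘q) A) (map-∘ A)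

  Grr'→Gr : CoveringMorphism prr' z q y*
  Grr'→Gr = LiftingCriterion.morphism (proj₁ lcrr') q-cov loops-Grr'⊆Gr

  Gr→Grr' : CoveringMorphism q y* prr' z
  Gr→Grr' = LiftingCriterion.morphism q-cov (proj₁ lcrr') loops-Gr⊆Grr'

lemma4p5 : (G : Graph) (x₀ : V G) → Connected G → (r r' : ℕ) → r ≤ r' →
    (Gr : Graph) (pr : Hom Gr G) (yr : V Gr) → IsLocalCovering G x₀ r Gr pr yr →
    (Gr' : Graph) (pr' : Hom Gr' G) (yr' : V Gr') → IsLocalCovering G x₀ r' Gr' pr' yr' →
    (Grr' : Graph) (prr' : Hom Grr' Gr') (z : V Grr') → IsLocalCovering Gr' yr' r Grr' prr' z →
    (q : Hom Gr Gr') → IsCovering q → pr ≈H (pr' ∘H q) →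
    EquivCov prr' q × EquivCov pr (pr' ∘H prr') × Iso Grr' Gr
lemma4p5 G x₀ _ r r' r≤r' Gr pr yr lcr Gr' pr' yr' lcr' Grr' prr' z lcrr' q q-cov pr≈pr'∘q =
  prr'≅q , EquivCov-∘ {p₁ = q} {p₂ = prr'} pr' {p = pr} pr≈pr'∘q q≅prr' , proj₁ prr'≅q
  where
  open LocalCoveringComparison G x₀ r r' r≤r' Gr pr yr lcr Gr' pr' yr' lcr' Grr' prr' z lcrr' q q-cov pr≈pr'∘q
  prr'≅q : EquivCov prr' q
  prr'≅q = CoveringMorphisms⇒EquivCov (proj₁ lcrr') q-cov Grr'→Gr Gr→Grr'
  q≅prr' : EquivCov q prr'
  q≅prr' = CoveringMorphisms⇒EquivCov q-cov (proj₁ lcrr') Gr→Grr' Grr'→Gr
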